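{- Let $\epsilon'>0$, let $P$ be a path from $u$ to $v$, and let $x\in P\setminus\{u,v\}$. Then $|\mathrm{seg}(x,P)|\le\epsilon'\cdot\min\{|P[u,x]|,|P[x,v]|\}$.
   Context: Paths are in a graph with edge weights in $[1,W]$; $|Q|$ denotes the weighted length of a path $Q$ and $P[x,y]$ the subpath of $P$ between $x$ and $y$. For a path $P=(u=v_0,v_1,\dots,v_\ell=v)$ and $\epsilon'>0$, two vertices $v_i,v_j$ with $1\le i,j<\ell$ are in the same ($\epsilon'$-)segment if either $|P[u,v_i]|,|P[u,v_j]|\le|P|/2$ and $\lfloor\log_{1+\epsilon'}|P[u,v_i]|\rfloor=\lfloor\log_{1+\epsilon'}|P[u,v_j]|\rfloor$, or $|P[v_i,v]|,|P[v_j,v]|<|P|/2$ and $\lfloor\log_{1+\epsilon'}|P[v_i,v]|\rfloor=\lfloor\log_{1+\epsilon'}|P[v_j,v]|\rfloor$. This is an equivalence relation whose classes are contiguous subpaths; for an internal vertex $x$ of $P$, $\mathrm{seg}(x,P)=P[v_l,v_r]$ where $v_l$ and $v_r$ are the vertices of the class of $x$ closest to $u$ and to $v$ respectively, and $|\mathrm{seg}(x,P)|$ is its length.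
   Formalization: The parameter $\epsilon'$, the edge weights and the bound W are rational. -}

module Defs where

open import Data.Nat as ℕ using (ℕ; zero; suc)
open import Data.Rational using (ℚ; 0ℚ; 1ℚ; ½; _+_; _-_; _*_; _≤_; _<_; _⊓_)
open import Data.List using (List; []; _∷_; length; take; foldr)
open import Data.Unit using (⊤)
open import Data.Product using (_×_; ∃)
open import Data.Sum using (_⊎_)

_^ℚ_ : ℚ → ℕ → ℚ
q ^ℚ zero  = 1ℚ
q ^ℚ suc n = q * (q ^ℚ n)

sumℚ : List ℚ → ℚ
sumℚ = foldr _+_ 0ℚ

-- A path P = (u = v_0, v_1, ..., v_ℓ = v) is represented by the list
-- of its edge weights ws (ℓ = length ws); edge i joins v_i and v_{i+1}.

WeightsIn : ℚ → List ℚ → Set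
WeightsIn W []       = ⊤
WeightsIn W (w ∷ ws) = (1ℚ ≤ w × w ≤ W) × WeightsIn W ws

-- |P[u, v_i]| = weight of the first i edges
dist : List ℚ → ℕ → ℚ
dist ws i = sumℚ (take i ws)

len : List ℚ → ℚ
len ws = sumℚ ws

subLen : List ℚ → ℕ → ℕ → ℚ
subLen ws i j = dist ws j - dist ws i

-- FloorLog b a k  means  ⌊log_b a⌋ = k  (for a ≥ 1, b > 1):  b^k ≤ a < b^(k+1)
FloorLog : ℚ → ℚ → ℕ → Set
FloorLog b a k = (b ^ℚ k ≤ a) × (a < b ^ℚ suc k)

SameFloorLog : ℚ → ℚ → ℚ → Set
SameFloorLog b a c = ∃ λ k → FloorLog b a k × FloorLog b c k

Internal : List ℚ → ℕ → Set
Internal ws i = 1 ℕ.≤ i × i ℕ.< length ws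

-- v_i and v_j are in the same ε'-segment of P
SameSeg : ℚ → List ℚ → ℕ → ℕ → Set
SameSeg ε ws i j =
  Internal ws i × Internal ws j ×
  ( (dist ws i ≤ ½ * len ws × dist ws j ≤ ½ * len ws ×
       SameFloorLog (1ℚ + ε) (dist ws i) (dist ws j))
  ⊎ (subLen ws i (length ws) < ½ * len ws × subLen ws j (length ws) < ½ * len ws ×
       SameFloorLog (1ℚ + ε) (subLen ws i (length ws)) (subLen ws j (length ws))) )

-- seg(x,P) = P[v_l, v_r] where l and r are the least and greatest indices
-- of the class of x
IsSegEnds : ℚ → List ℚ → ℕ → ℕ → ℕ → Set
IsSegEnds ε ws x l r =
  SameSeg ε ws x l × SameSeg ε ws x r ×
  (∀ j → SameSeg ε ws x j → l ℕ.≤ j × j ℕ.≤ r)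

-- With b = 1 + ε', every vertex of the segment of x lies, measured from the endpoint on
-- x's side of the midpoint, at a distance in the same interval [bᵏ, bᵏ⁺¹) as x. Hence the
-- segment is shorter than bᵏ⁺¹ - bᵏ = ε' bᵏ ≤ ε' times the distance of x to that endpoint,
-- which is the smaller of |P[u,x]| and |P[x,v]|.
module Submission where

open import Defs
open import Data.Nat as ℕ using (ℕ)
import Data.Nat.Properties as ℕ
open import Data.Rational using (ℚ; 0ℚ; 1ℚ; ½; _+_; -_; _-_; _*_; _≤_; _<_; _⊓_; nonNegative)
open import Data.Rational.Properties
open import Data.Rational.Solver using (module +-*-Solver)
open import Data.List using (List; length)
open import Data.List.Properties using (take-all)
open import Data.Product using (_×_; _,_; proj₁)
open import Data.Sum using (_⊎_; inj₁; inj₂)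
open import Data.Empty using (⊥; ⊥-elim)
open import Relation.Binary.PropositionalEquality using (_≡_; refl; sym; cong; subst; subst₂)

open +-*-Solver

0≤1 : 0ℚ ≤ 1ℚ
0≤1 = nonNegative⁻¹ 1ℚ

1≤1+ε : ∀ {ε} → 0ℚ ≤ ε → 1ℚ ≤ 1ℚ + ε
1≤1+ε {ε} 0≤ε = subst (_≤ 1ℚ + ε) (+-identityʳ 1ℚ) (+-monoʳ-≤ 1ℚ 0≤ε)

^ℚ-nonNeg : ∀ {b} → 0ℚ ≤ b → ∀ n → 0ℚ ≤ b ^ℚ n
^ℚ-nonNeg 0≤b ℕ.zero = 0≤1
^ℚ-nonNeg {b} 0≤b (ℕ.suc n) = nonNegative⁻¹ (b * (b ^ℚ n))
  {{nonNeg*nonNeg⇒nonNeg b {{nonNegative 0≤b}} (b ^ℚ n) {{nonNegative (^ℚ-nonNeg 0≤b n)}}}}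

^ℚ-≤-^ℚ-suc : ∀ {b} → 1ℚ ≤ b → ∀ n → b ^ℚ n ≤ b ^ℚ ℕ.suc n
^ℚ-≤-^ℚ-suc {b} 1≤b n = subst (_≤ b * (b ^ℚ n)) (*-identityˡ (b ^ℚ n))
  (*-monoʳ-≤-nonNeg (b ^ℚ n) {{nonNegative (^ℚ-nonNeg (≤-trans 0≤1 1≤b) n)}} 1≤b)

^ℚ-monoʳ-≤ : ∀ {b m n} → 1ℚ ≤ b → m ℕ.≤′ n → b ^ℚ m ≤ b ^ℚ n
^ℚ-monoʳ-≤ 1≤b ℕ.≤′-refl          = ≤-refl
^ℚ-monoʳ-≤ 1≤b (ℕ.≤′-step {n} m≤n) = ≤-trans (^ℚ-monoʳ-≤ 1≤b m≤n) (^ℚ-≤-^ℚ-suc 1≤b n)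

floorLog-≤ : ∀ {b a k k′} → 1ℚ ≤ b → FloorLog b a k → FloorLog b a k′ → k ℕ.≤ k′
floorLog-≤ 1≤b (bᵏ≤a , _) (_ , a<bᵏ′⁺¹) = ℕ.≮⇒≥ λ k′<k →
  <-irrefl refl (<-≤-trans a<bᵏ′⁺¹ (≤-trans (^ℚ-monoʳ-≤ 1≤b (ℕ.≤⇒≤′ k′<k)) bᵏ≤a))

floorLog-unique : ∀ {b a k k′} → 1ℚ ≤ b → FloorLog b a k → FloorLog b a k′ → k ≡ k′
floorLog-unique 1≤b f f′ = ℕ.≤-antisym (floorLog-≤ 1≤b f f′) (floorLog-≤ 1≤b f′ f)

-- The interval [bᵏ, (1 + ε) bᵏ) has length ε bᵏ, and bᵏ ≤ a.
sameFloorLog-spread : ∀ {ε a c e} → 0ℚ ≤ ε →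
  SameFloorLog (1ℚ + ε) a c → SameFloorLog (1ℚ + ε) a e → e - c ≤ ε * a
sameFloorLog-spread {ε} {a} {c} {e} 0≤ε (k , fa , (bᵏ≤c , _)) (k′ , fa′ , (_ , e<bᵏ⁺¹))
  with floorLog-unique {k = k} {k′} (1≤1+ε 0≤ε) fa fa′
... | refl = begin
  e - c              ≤⟨ +-monoʳ-≤ e (neg-antimono-≤ bᵏ≤c) ⟩
  e - bᵏ             ≤⟨ <⇒≤ (+-monoˡ-< (- bᵏ) e<bᵏ⁺¹) ⟩
  (1ℚ + ε) * bᵏ - bᵏ ≡⟨ solve 2 (λ ε x → (con 1ℚ :+ ε) :* x :- x := ε :* x) refl ε bᵏ ⟩
  ε * bᵏ             ≤⟨ *-monoˡ-≤-nonNeg ε {{nonNegative 0≤ε}} (proj₁ fa) ⟩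
  ε * a              ∎
  where
    open ≤-Reasoning
    bᵏ = (1ℚ + ε) ^ℚ k

½-+-½ : ∀ T → ½ * T + ½ * T ≡ T
½-+-½ = solve 1 (λ T → con ½ :* T :+ con ½ :* T := T) refl

≤½⇒≤compl : ∀ T {d} → d ≤ ½ * T → d ≤ T - d
≤½⇒≤compl T {d} d≤½T = begin
  d                 ≡⟨ solve 1 (λ d → d := d :+ d :- d) refl d ⟩
  d + d - d         ≤⟨ +-monoˡ-≤ (- d) (+-mono-≤ d≤½T d≤½T) ⟩
  ½ * T + ½ * T - d ≡⟨ cong (_- d) (½-+-½ T) ⟩
  T - d             ∎
  where open ≤-Reasoning

compl<½⇒compl< : ∀ T {d} → T - d < ½ * T → T - d < d
compl<½⇒compl< T {d} T-d<½T = begin-strict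
  T - d                       ≡⟨ solve 1 (λ c → c := c :+ c :- c) refl (T - d) ⟩
  (T - d) + (T - d) - (T - d) <⟨ +-monoˡ-< (- (T - d)) (+-mono-< T-d<½T T-d<½T) ⟩
  ½ * T + ½ * T - (T - d)     ≡⟨ cong (_- (T - d)) (½-+-½ T) ⟩
  T - (T - d)                 ≡⟨ solve 2 (λ T d → T :- (T :- d) := d) refl T d ⟩
  d                           ∎
  where open ≤-Reasoning

≤½-compl<½-exclusive : ∀ T {d} → d ≤ ½ * T → T - d < ½ * T → ⊥
≤½-compl<½-exclusive T d≤½T T-d<½T =
  <-irrefl refl (<-≤-trans (compl<½⇒compl< T T-d<½T) (≤½⇒≤compl T d≤½T))

SameSegmentAt : ℚ → ℚ → ℚ → ℚ → Set
SameSegmentAt ε T a c =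
    (a ≤ ½ * T × c ≤ ½ * T × SameFloorLog (1ℚ + ε) a c)
  ⊎ (T - a < ½ * T × T - c < ½ * T × SameFloorLog (1ℚ + ε) (T - a) (T - c))

sameSegmentAt-spread : ∀ {ε} T {a c e} → 0ℚ ≤ ε →
  SameSegmentAt ε T a c → SameSegmentAt ε T a e → e - c ≤ ε * (a ⊓ (T - a))
sameSegmentAt-spread {ε} T {a} {c} {e} 0≤ε (inj₁ (a≤½T , _ , ac)) (inj₁ (_ , _ , ae)) =
  subst (λ m → e - c ≤ ε * m) (sym (p≤q⇒p⊓q≡p (≤½⇒≤compl T a≤½T)))
    (sameFloorLog-spread 0≤ε ac ae)
sameSegmentAt-spread {ε} T {a} {c} {e} 0≤ε (inj₂ (T-a<½T , _ , ac)) (inj₂ (_ , _ , ae)) =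
  subst₂ (λ s m → s ≤ ε * m)
    (solve 3 (λ T c e → (T :- c) :- (T :- e) := e :- c) refl T c e)
    (sym (p≥q⇒p⊓q≡q (<⇒≤ (compl<½⇒compl< T T-a<½T))))
    (sameFloorLog-spread 0≤ε ae ac)
sameSegmentAt-spread T _ (inj₁ (a≤½T , _)) (inj₂ (T-a<½T , _)) =
  ⊥-elim (≤½-compl<½-exclusive T a≤½T T-a<½T)
sameSegmentAt-spread T _ (inj₂ (T-a<½T , _)) (inj₁ (a≤½T , _)) =
  ⊥-elim (≤½-compl<½-exclusive T a≤½T T-a<½T)

dist-length : ∀ ws → dist ws (length ws) ≡ len ws
dist-length ws = cong sumℚ (take-all (length ws) ws ℕ.≤-refl)

lemma3p2 : (ε W : ℚ) → 0ℚ < ε → (ws : List ℚ) → WeightsIn W ws →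
    (x : ℕ) → Internal ws x → (l r : ℕ) → IsSegEnds ε ws x l r →
    subLen ws l r ≤ ε * (dist ws x ⊓ subLen ws x (length ws))
lemma3p2 ε W ε>0 ws _ x _ l r ((_ , _ , x∼l) , (_ , _ , x∼r) , _)
  rewrite sym (dist-length ws) = sameSegmentAt-spread (dist ws (length ws)) (<⇒≤ ε>0) x∼l x∼r
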